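{- Let $n, r$ be nonnegative integers with $n\geqslant\lceil r/2\rceil+2$. Then $m(L(K_n),r)\leqslant\lfloor (r+2)^2/8\rfloor$.
   Context: All graphs are finite, simple and undirected. For an integer $r\geqslant 0$ and a graph $G$, the $r$-neighbor bootstrap percolation process on $G$ starts with a set $A_0\subseteq V(G)$ of initially active vertices, and for $i\geqslant 1$, $A_i=A_{i-1}\cup\{v\in V(G): |N(v)\cap A_{i-1}|\geqslant r\}$, where $N(v)$ is the set of neighbors of $v$; $A_0$ is a percolating set if $\bigcup_{i\geqslant 0}A_i=V(G)$. $m(G,r)$ is the minimum size of a percolating set. The line graph $L(G)$ has vertex set $E(G)$, two vertices adjacent iff the corresponding edges share an endpoint. $K_n$ is the complete graph on $n$ vertices. -}

module Defs where

open import Data.Bool using (Bool; true; false; _∧_; _∨_; not)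
open import Data.Nat using (ℕ; zero; suc; _≤ᵇ_; _<ᵇ_; _≤_)
open import Data.Fin using (Fin; toℕ)
open import Data.Fin.Properties using (_≟_)
open import Data.List using (List; []; _∷_; length; allFin; cartesianProduct; filterᵇ)
open import Data.Bool.ListAction using (any)
open import Data.List.Membership.Propositional using (_∈_)
open import Data.List.Relation.Unary.All using (All)
open import Data.List.Relation.Unary.Unique.Propositional using (Unique)
open import Data.Product using (_×_; _,_; ∃; ∃-syntax; Σ)
open import Relation.Nullary.Decidable using (⌊_⌋)
open import Relation.Binary.PropositionalEquality using (_≡_)

-- A finite simple graph presented by a (duplicate-free) list of its vertices
-- (drawn from an ambient type V) and a Boolean adjacency test.
record FinGraph (V : Set) : Set where
  constructor mkGraph
  field
    verts   : List V
    adj     : V → V → Bool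

count : {A : Set} → (A → Bool) → List A → ℕ
count p []       = 0
count p (x ∷ xs) with p x
... | true  = suc (count p xs)
... | false = count p xs

module Bootstrap {V : Set} (G : FinGraph V) (eqᵇ : V → V → Bool) (r : ℕ) (A₀ : List V) where
  open FinGraph G

  -- A i v ≡ true  iff  v ∈ A_i  in the r-neighbor bootstrap process from A₀
  A : ℕ → V → Bool
  A zero    v = any (eqᵇ v) A₀
  A (suc i) v = A i v ∨ (r ≤ᵇ count (λ u → adj v u ∧ A i u) verts)

  Percolates : Set
  Percolates = ∀ v → v ∈ verts → ∃[ i ] (A i v ≡ true)

-- m(G,r) ≤ b : there is a percolating set A₀ ⊆ V(G) with |A₀| ≤ b
m≤ : {V : Set} → FinGraph V → (V → V → Bool) → ℕ → ℕ → Set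
m≤ {V} G eqᵇ r b =
  ∃[ A₀ ] (All (_∈ FinGraph.verts G) A₀ × Unique A₀ × length A₀ ≤ b
           × Bootstrap.Percolates G eqᵇ r A₀)

-- Edges of K_n, encoded as pairs (i , j) with i < j.
Pair : ℕ → Set
Pair n = Fin n × Fin n

eqFin : {n : ℕ} → Fin n → Fin n → Bool
eqFin i j = ⌊ i ≟ j ⌋

eqPair : {n : ℕ} → Pair n → Pair n → Bool
eqPair (i , j) (k , l) = eqFin i k ∧ eqFin j l

edgesK : (n : ℕ) → List (Pair n)
edgesK n = filterᵇ (λ { (i , j) → toℕ i <ᵇ toℕ j }) (cartesianProduct (allFin n) (allFin n))

adjL : {n : ℕ} → Pair n → Pair n → Bool
adjL (i , j) (k , l) =
  not (eqPair (i , j) (k , l)) ∧ (eqFin i k ∨ eqFin i l ∨ eqFin j k ∨ eqFin j l)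


LK : (n : ℕ) → FinGraph (Pair n)
LK n = mkGraph (edgesK n) adjL

module Submission where

-- Write r = 2t + o with o ∈ {0,1}, put T = t + o = ⌈r/2⌉ and n = k + T + 1 with k ≥ 1.
-- On the vertices 0,…,n-1 of K_n the initially active edges ab (a < b) are
--   * the long edges, b > a + k   (row a contains T ∸ a of them), and
--   * for even r only, the matching edges (a, a+1) with a odd and a ≤ t.
-- Hence 2|A₀| ≤ T(T+1) + (t+1)[r even], i.e. 8|A₀| ≤ (r+2)².  All other edges are
-- activated in lexicographic order: when the short edge ij (i < j ≤ i + k) is reached,
-- the edges xi (x < i), ix (i < x < j), ix (x > i + k), yj (y < i) and jy (y > j + k)
-- are already active; these are i + (j-i-1) + (T-i) + i + (T-j) ≥ 2T - 1 edges, and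
-- for even r with j ≤ t a matching edge at j supplies the one that is missing.

open import Defs
open import Data.Bool using (Bool; true; false; _∧_; _∨_; not; T; if_then_else_)
open import Data.Bool.Properties using (∨-zeroʳ; ∧-zeroʳ; not-injective)
open import Data.Empty using (⊥-elim)
open import Data.Fin using (Fin; toℕ) renaming (zero to fzero; suc to fsuc)
open import Data.Fin.Properties using (toℕ<n; toℕ-injective) renaming (_≟_ to _≟ᶠ_)
open import Data.List using (List; []; _∷_; length; map; _++_; filterᵇ; tabulate; allFin; cartesianProduct)
open import Data.List.Properties using (length-++; length-map)
open import Data.List.Membership.Propositional using (_∈_; lose)
open import Data.List.Membership.Propositional.Properties
  using (∈-filter⁺; ∈-filter⁻; ∈-cartesianProduct⁺; ∈-allFin; ∈-map⁻; ∈-++⁻)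
import Data.List.Membership.DecPropositional as DecMembership
open import Data.List.Relation.Unary.All using (All; []; _∷_)
import Data.List.Relation.Unary.All as All
open import Data.List.Relation.Unary.AllPairs using ([]; _∷_)
open import Data.List.Relation.Unary.Any using (here; there)
open import Data.List.Relation.Unary.Any.Properties using (any⁺)
open import Data.List.Relation.Unary.Unique.Propositional using (Unique)
open import Data.List.Relation.Unary.Unique.Propositional.Properties
  using (++⁺; map⁺; filter⁺; allFin⁺; cartesianProduct⁺)
open import Data.Nat
  using (ℕ; zero; suc; _+_; _*_; _∸_; _^_; _≤_; _<_; _⊓_; _≤ᵇ_; _<ᵇ_; _≡ᵇ_; _≤′_; ≤′-refl; ≤′-step;
         z≤n; s≤s; s≤s⁻¹; _≤?_; ⌈_/2⌉)
open import Data.Nat.DivMod using (_/_; m*n/n≡m; /-monoˡ-≤)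
open import Data.Nat.ListAction using (sum)
open import Data.Nat.Properties
open import Algebra.Properties.CommutativeSemigroup +-commutativeSemigroup using (interchange)
open import Data.Nat.Tactic.RingSolver using (solve-∀)
open import Data.Product using (_×_; _,_; ∃-syntax; proj₁; proj₂)
open import Data.Product.Properties using (≡-dec)
open import Data.Sum using (_⊎_; inj₁; inj₂)
open import Relation.Binary.Definitions using (DecidableEquality)
open import Relation.Binary.PropositionalEquality
open import Relation.Nullary using (¬_; yes; no)
open import Relation.Nullary.Decidable using (T?)

private variable
  X Y : Set

bit : Bool → ℕ
bit true  = 1
bit false = 0

T⇒true : ∀ {b} → T b → b ≡ true
T⇒true {true} _ = refl

true⇒T : ∀ {b} → b ≡ true → T b
true⇒T refl = _

∨-true : ∀ {a b} → a ∨ b ≡ true → a ≡ true ⊎ b ≡ true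
∨-true {true}  _ = inj₁ refl
∨-true {false} e = inj₂ e

∨-false : ∀ {a b} → a ∨ b ≡ false → a ≡ false × b ≡ false
∨-false {false} e = refl , e

∧-true : ∀ {a b} → a ∧ b ≡ true → a ≡ true × b ≡ true
∧-true {true} e = refl , e

<ᵇ-true : ∀ {m n} → m < n → (m <ᵇ n) ≡ true
<ᵇ-true m<n = T⇒true (<⇒<ᵇ m<n)

<ᵇ-true⁻ : ∀ {m n} → (m <ᵇ n) ≡ true → m < n
<ᵇ-true⁻ {m} {n} e = <ᵇ⇒< m n (true⇒T e)

<ᵇ-false : ∀ {m n} → n ≤ m → (m <ᵇ n) ≡ false
<ᵇ-false {m} {n} n≤m with m <ᵇ n in e
... | false = refl
... | true  = ⊥-elim (<⇒≱ (<ᵇ-true⁻ e) n≤m)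

<ᵇ-false⁻ : ∀ {m n} → (m <ᵇ n) ≡ false → n ≤ m
<ᵇ-false⁻ e = ≮⇒≥ (λ m<n → subst T e (<⇒<ᵇ m<n))

-- flips b a is b negated a times; so flips false a ≡ true iff a is odd
flips : Bool → ℕ → Bool
flips b zero    = b
flips b (suc a) = flips (not b) a

flips-not : ∀ b a → flips (not b) a ≡ not (flips b a)
flips-not b zero    = refl
flips-not b (suc a) = flips-not (not b) a

count-∷ : (p : X → Bool) (x : X) (xs : List X) → count p (x ∷ xs) ≡ bit (p x) + count p xs
count-∷ p x xs with p x
... | true  = refl
... | false = refl

count-++ : (p : X → Bool) (xs ys : List X) → count p (xs ++ ys) ≡ count p xs + count p ys
count-++ p []       ys = refl
count-++ p (x ∷ xs) ys rewrite count-∷ p x (xs ++ ys) | count-∷ p x xs | count-++ p xs ys =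
  sym (+-assoc (bit (p x)) (count p xs) (count p ys))

count-map : (p : Y → Bool) (f : X → Y) (xs : List X) →
  count p (map f xs) ≡ count (λ x → p (f x)) xs
count-map p f []       = refl
count-map p f (x ∷ xs)
  rewrite count-∷ p (f x) (map f xs) | count-∷ (λ x → p (f x)) x xs | count-map p f xs = refl

count-filterᵇ : (q p : X → Bool) (xs : List X) →
  count p (filterᵇ q xs) ≡ count (λ x → q x ∧ p x) xs
count-filterᵇ q p []       = refl
count-filterᵇ q p (x ∷ xs) rewrite count-∷ (λ x → q x ∧ p x) x xs with q x
... | true  rewrite count-∷ p x (filterᵇ q xs) | count-filterᵇ q p xs = refl
... | false = count-filterᵇ q p xs

length-filterᵇ : (q : X → Bool) (xs : List X) → length (filterᵇ q xs) ≡ count q xs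
length-filterᵇ q []       = refl
length-filterᵇ q (x ∷ xs) rewrite count-∷ q x xs with q x
... | true  = cong suc (length-filterᵇ q xs)
... | false = length-filterᵇ q xs

count-cartesianProduct : (p : X × Y → Bool) (xs : List X) (ys : List Y) →
  count p (cartesianProduct xs ys) ≡ sum (map (λ x → count (λ y → p (x , y)) ys) xs)
count-cartesianProduct p []       ys = refl
count-cartesianProduct p (x ∷ xs) ys =
  trans (count-++ p (map (x ,_) ys) (cartesianProduct xs ys))
        (cong₂ _+_ (count-map p (x ,_) ys) (count-cartesianProduct p xs ys))

-- Deleting the occurrence of an element designated by a membership proof; needed to
-- compare a duplicate-free list with a list containing its elements.
remove : {x : X} (L : List X) → x ∈ L → List X
remove (_ ∷ L) (here _)  = L
remove (z ∷ L) (there m) = z ∷ remove L m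

length-remove : {x : X} (L : List X) (m : x ∈ L) → length L ≡ suc (length (remove L m))
length-remove (_ ∷ L) (here _)  = refl
length-remove (z ∷ L) (there m) = cong suc (length-remove L m)

remove-⊆ : {x w : X} (L : List X) (m : x ∈ L) → w ∈ remove L m → w ∈ L
remove-⊆ (_ ∷ L) (here _)  w∈       = there w∈
remove-⊆ (z ∷ L) (there m) (here e) = here e
remove-⊆ (z ∷ L) (there m) (there w∈) = there (remove-⊆ L m w∈)

All-∈ : {P : X → Set} {L : List X} {w : X} → All P L → w ∈ L → P w
All-∈ (p ∷ _)  (here refl) = p
All-∈ (_ ∷ ps) (there m)   = All-∈ ps m

remove-≢ : {x w : X} (L : List X) (m : x ∈ L) → Unique L → w ∈ remove L m → w ≢ x
remove-≢ (_ ∷ L) (here refl) (x∉ ∷ _) w∈ = λ w≡x → All-∈ x∉ w∈ (sym w≡x)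
remove-≢ (z ∷ L) (there m) (z∉ ∷ _) (here refl) = All-∈ z∉ m
remove-≢ (z ∷ L) (there m) (_ ∷ u) (there w∈) = remove-≢ L m u w∈

All-remove : {P : X → Set} {x : X} (L : List X) (m : x ∈ L) → All P L → All P (remove L m)
All-remove (_ ∷ L) (here _)  (_ ∷ ps) = ps
All-remove (z ∷ L) (there m) (p ∷ ps) = p ∷ All-remove L m ps

Unique-remove : {x : X} (L : List X) (m : x ∈ L) → Unique L → Unique (remove L m)
Unique-remove (_ ∷ L) (here _)  (_ ∷ u)   = u
Unique-remove (z ∷ L) (there m) (z∉ ∷ u) = All-remove L m z∉ ∷ Unique-remove L m u

module _ (_≟_ : DecidableEquality X) where
  open DecMembership _≟_ using (_∈?_)

  count-≥-unique : (p : X → Bool) (ys L : List X) → Unique L → (∀ {x} → x ∈ L → x ∈ ys) →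
    (∀ {x} → x ∈ L → p x ≡ true) → length L ≤ count p ys
  count-≥-unique p [] [] _ _ _ = z≤n
  count-≥-unique p [] (x ∷ L) _ L⊆ys _ with L⊆ys (here refl)
  ... | ()
  count-≥-unique p (y ∷ ys) L u L⊆y∷ys pL with y ∈? L
  ... | yes y∈L rewrite count-∷ p y ys | pL y∈L | length-remove L y∈L =
    s≤s (count-≥-unique p ys (remove L y∈L) (Unique-remove L y∈L u) rest⊆ys
                        (λ w∈ → pL (remove-⊆ L y∈L w∈)))
    where
    rest⊆ys : ∀ {x} → x ∈ remove L y∈L → x ∈ ys
    rest⊆ys w∈ with L⊆y∷ys (remove-⊆ L y∈L w∈)
    ... | here w≡y  = ⊥-elim (remove-≢ L y∈L u w∈ w≡y)
    ... | there w∈ys = w∈ys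
  ... | no y∉L rewrite count-∷ p y ys =
    ≤-trans (count-≥-unique p ys L u L⊆ys pL) (m≤n+m _ (bit (p y)))
    where
    L⊆ys : ∀ {x} → x ∈ L → x ∈ ys
    L⊆ys w∈ with L⊆y∷ys w∈
    ... | here refl  = ⊥-elim (y∉L w∈)
    ... | there w∈ys = w∈ys

countBelow : (ℕ → Bool) → ℕ → ℕ
countBelow q zero    = 0
countBelow q (suc n) = bit (q 0) + countBelow (λ x → q (suc x)) n

sumBelow : (ℕ → ℕ) → ℕ → ℕ
sumBelow f zero    = 0
sumBelow f (suc n) = f 0 + sumBelow (λ x → f (suc x)) n

count-tabulate : ∀ n (g : Fin n → X) (p : X → Bool) (q : ℕ → Bool) →
  (∀ x → p (g x) ≡ q (toℕ x)) → count p (tabulate g) ≡ countBelow q n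
count-tabulate zero    g p q e = refl
count-tabulate (suc n) g p q e rewrite count-∷ p (g fzero) (tabulate (λ x → g (fsuc x))) | e fzero =
  cong (bit (q 0) +_) (count-tabulate n (λ x → g (fsuc x)) p (λ x → q (suc x)) (λ x → e (fsuc x)))

count-allFin : ∀ n (q : ℕ → Bool) → count (λ x → q (toℕ x)) (allFin n) ≡ countBelow q n
count-allFin n q = count-tabulate n (λ x → x) (λ x → q (toℕ x)) q (λ _ → refl)

sum-tabulate : ∀ n (g : Fin n → X) (h : X → ℕ) (f : ℕ → ℕ) →
  (∀ x → h (g x) ≡ f (toℕ x)) → sum (map h (tabulate g)) ≡ sumBelow f n
sum-tabulate zero    g h f e = refl
sum-tabulate (suc n) g h f e rewrite e fzero =
  cong (f 0 +_) (sum-tabulate n (λ x → g (fsuc x)) h (λ x → f (suc x)) (λ x → e (fsuc x)))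

countBelow-cong : {p q : ℕ → Bool} → (∀ x → p x ≡ q x) → ∀ n → countBelow p n ≡ countBelow q n
countBelow-cong e zero    = refl
countBelow-cong e (suc n) rewrite e 0 = cong (_ +_) (countBelow-cong (λ x → e (suc x)) n)

sumBelow-cong : {f g : ℕ → ℕ} → (∀ x → f x ≡ g x) → ∀ n → sumBelow f n ≡ sumBelow g n
sumBelow-cong e zero    = refl
sumBelow-cong e (suc n) rewrite e 0 = cong (_ +_) (sumBelow-cong (λ x → e (suc x)) n)

bit-mono : {a b : Bool} → (a ≡ true → b ≡ true) → bit a ≤ bit b
bit-mono {false} _   = z≤n
bit-mono {true}  a⇒b rewrite a⇒b refl = ≤-refl

countBelow-mono : {p q : ℕ → Bool} → (∀ x → p x ≡ true → q x ≡ true) → ∀ n →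
  countBelow p n ≤ countBelow q n
countBelow-mono p⇒q zero    = z≤n
countBelow-mono p⇒q (suc n) = +-mono-≤ (bit-mono (p⇒q 0)) (countBelow-mono (λ x → p⇒q (suc x)) n)

sumBelow-mono : {f g : ℕ → ℕ} → (∀ x → f x ≤ g x) → ∀ n → sumBelow f n ≤ sumBelow g n
sumBelow-mono f≤g zero    = z≤n
sumBelow-mono f≤g (suc n) = +-mono-≤ (f≤g 0) (sumBelow-mono (λ x → f≤g (suc x)) n)

sumBelow-+ : (f g : ℕ → ℕ) → ∀ n → sumBelow (λ x → f x + g x) n ≡ sumBelow f n + sumBelow g n
sumBelow-+ f g zero    = refl
sumBelow-+ f g (suc n) = trans (cong (f 0 + g 0 +_) (sumBelow-+ (λ x → f (suc x)) (λ x → g (suc x)) n))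
                               (interchange (f 0) (g 0) _ _)

sumBelow-zero : ∀ n → sumBelow (λ _ → 0) n ≡ 0
sumBelow-zero zero    = refl
sumBelow-zero (suc n) = sumBelow-zero n

countBelow-false : (p : ℕ → Bool) → (∀ x → p x ≡ false) → ∀ n → countBelow p n ≡ 0
countBelow-false p p≡false zero    = refl
countBelow-false p p≡false (suc n) rewrite p≡false 0 =
  countBelow-false (λ x → p (suc x)) (λ x → p≡false (suc x)) n

countBelow-∨ : (p q : ℕ → Bool) → ∀ n → countBelow (λ x → p x ∨ q x) n ≤ countBelow p n + countBelow q n
countBelow-∨ p q zero    = z≤n
countBelow-∨ p q (suc n) =
  ≤-trans (+-mono-≤ (bit-∨ (p 0) (q 0)) (countBelow-∨ (λ x → p (suc x)) (λ x → q (suc x)) n))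
          (≤-reflexive (interchange (bit (p 0)) (bit (q 0)) _ _))
  where
  bit-∨ : (a b : Bool) → bit (a ∨ b) ≤ bit a + bit b
  bit-∨ false b     = ≤-refl
  bit-∨ true  false = ≤-refl
  bit-∨ true  true  = s≤s z≤n

countBelow-∨-disjoint : (p q : ℕ → Bool) → (∀ x → p x ≡ true → q x ≡ false) → ∀ n →
  countBelow p n + countBelow q n ≤ countBelow (λ x → p x ∨ q x) n
countBelow-∨-disjoint p q disj zero    = z≤n
countBelow-∨-disjoint p q disj (suc n) =
  ≤-trans (≤-reflexive (interchange (bit (p 0)) _ (bit (q 0)) _))
          (+-mono-≤ (bit-∨ (p 0) (q 0) (disj 0))
                    (countBelow-∨-disjoint (λ x → p (suc x)) (λ x → q (suc x)) (λ x → disj (suc x)) n))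
  where
  bit-∨ : (a b : Bool) → (a ≡ true → b ≡ false) → bit a + bit b ≤ bit (a ∨ b)
  bit-∨ false b _ = ≤-refl
  bit-∨ true  b a⇒¬b rewrite a⇒¬b refl = ≤-refl

countBelow-witness : (p : ℕ → Bool) (y : ℕ) → p y ≡ true → ∀ n → y < n → 1 ≤ countBelow p n
countBelow-witness p zero    py (suc n) _ rewrite py = s≤s z≤n
countBelow-witness p (suc y) py (suc n) (s≤s y<n) =
  ≤-trans (countBelow-witness (λ x → p (suc x)) y py n y<n) (m≤n+m _ (bit (p 0)))

countBelow-single : ∀ c m n → countBelow (λ x → c ∧ (x ≡ᵇ m)) n ≤ bit c
countBelow-single false m       n       = ≤-reflexive (countBelow-false _ (λ _ → refl) n)
countBelow-single true  m       zero    = z≤n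
countBelow-single true  zero    (suc n) = s≤s (≤-reflexive (countBelow-false _ (λ _ → refl) n))
countBelow-single true  (suc m) (suc n) = countBelow-single true m n

countBelow-< : ∀ b n → countBelow (λ x → x <ᵇ b) n ≡ b ⊓ n
countBelow-< zero    n       = countBelow-false _ (λ _ → refl) n
countBelow-< (suc b) zero    = refl
countBelow-< (suc b) (suc n) = cong suc (countBelow-< b n)

≤ᵇ-suc : ∀ a x → (suc a ≤ᵇ suc x) ≡ (a ≤ᵇ x)
≤ᵇ-suc zero    x = refl
≤ᵇ-suc (suc a) x = refl

countBelow-≥ : ∀ c n → countBelow (λ x → c ≤ᵇ x) n ≡ n ∸ c
countBelow-≥ zero    zero    = refl
countBelow-≥ zero    (suc n) = cong suc (countBelow-≥ zero n)
countBelow-≥ (suc c) zero    = refl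
countBelow-≥ (suc c) (suc n) = trans (countBelow-cong (≤ᵇ-suc c) n) (countBelow-≥ c n)

interval : ℕ → ℕ → ℕ → Bool
interval a b x = (a ≤ᵇ x) ∧ (x <ᵇ b)

countBelow-interval : ∀ a b n → countBelow (interval a b) n ≡ (b ⊓ n) ∸ a
countBelow-interval a       b       zero    = sym (trans (cong (_∸ a) (⊓-zeroʳ b)) (0∸n≡0 a))
countBelow-interval a       zero    (suc n) =
  trans (countBelow-false _ (λ x → ∧-zeroʳ (a ≤ᵇ x)) (suc n)) (sym (0∸n≡0 a))
countBelow-interval zero    (suc b) (suc n) = cong suc (countBelow-interval zero b n)
countBelow-interval (suc a) (suc b) (suc n) =
  trans (countBelow-cong (λ x → cong (_∧ (x <ᵇ b)) (≤ᵇ-suc a x)) n) (countBelow-interval a b n)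

sumBelow-triangle : ∀ c m → c ≤ m → 2 * sumBelow (λ a → c ∸ a) m ≡ c * suc c
sumBelow-triangle zero    m       _ = cong (2 *_) (trans (sumBelow-cong 0∸n≡0 m) (sumBelow-zero m))
sumBelow-triangle (suc c) (suc m) (s≤s c≤m) = begin
  2 * (suc c + S)       ≡⟨ *-distribˡ-+ 2 (suc c) S ⟩
  2 * suc c + 2 * S     ≡⟨ cong (2 * suc c +_) (sumBelow-triangle c m c≤m) ⟩
  2 * suc c + c * suc c ≡⟨ sym (*-distribʳ-+ (suc c) 2 c) ⟩
  (2 + c) * suc c       ≡⟨ *-comm (2 + c) (suc c) ⟩
  suc c * suc (suc c)   ∎
  where
  open ≡-Reasoning
  S : ℕ
  S = sumBelow (λ a → c ∸ a) m

sumBelow-flips : ∀ b c m → 2 * sumBelow (λ a → bit (flips b a ∧ (a <ᵇ c))) m ≤ c + bit b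
sumBelow-flips b c       zero    = z≤n
sumBelow-flips b zero    (suc m) =
  ≤-trans (≤-reflexive (cong (2 *_) (trans (sumBelow-cong (λ a → cong bit (∧-zeroʳ (flips b a))) (suc m))
                                           (sumBelow-zero (suc m)))))
          z≤n
sumBelow-flips true  (suc c) (suc m) = begin
  2 * (1 + S)  ≡⟨ *-distribˡ-+ 2 1 S ⟩
  2 + 2 * S    ≤⟨ +-monoʳ-≤ 2 (sumBelow-flips false c m) ⟩
  2 + (c + 0)  ≡⟨ cong (2 +_) (+-identityʳ c) ⟩
  2 + c        ≡⟨ cong suc (+-comm 1 c) ⟩
  suc c + 1    ∎
  where
  open ≤-Reasoning
  S : ℕ
  S = sumBelow (λ a → bit (flips false a ∧ (a <ᵇ c))) m
sumBelow-flips false (suc c) (suc m) =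
  ≤-trans (sumBelow-flips true c m) (≤-reflexive (trans (+-comm c 1) (sym (+-identityʳ (suc c)))))

module _ {n : ℕ} where

  eqFin-refl : (i : Fin n) → eqFin i i ≡ true
  eqFin-refl i with i ≟ᶠ i
  ... | yes _  = refl
  ... | no i≢i = ⊥-elim (i≢i refl)

  eqFin-≢ : {i j : Fin n} → i ≢ j → eqFin i j ≡ false
  eqFin-≢ {i} {j} i≢j with i ≟ᶠ j
  ... | yes i≡j = ⊥-elim (i≢j i≡j)
  ... | no _    = refl

  eqPair-refl : (u : Pair n) → eqPair u u ≡ true
  eqPair-refl (i , j) rewrite eqFin-refl i | eqFin-refl j = refl

  <⇒≢ᶠ : {a b : Fin n} → toℕ a < toℕ b → a ≢ b
  <⇒≢ᶠ a<b refl = <-irrefl refl a<b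

  ∈edgesK : (a b : Fin n) → toℕ a < toℕ b → (a , b) ∈ edgesK n
  ∈edgesK a b a<b = ∈-filter⁺ _ (∈-cartesianProduct⁺ (∈-allFin a) (∈-allFin b)) (<⇒<ᵇ a<b)

  ∈edgesK⁻ : {a b : Fin n} → (a , b) ∈ edgesK n → toℕ a < toℕ b
  ∈edgesK⁻ a,b∈ = <ᵇ⇒< _ _ (proj₂ (∈-filter⁻ _ {xs = cartesianProduct (allFin n) (allFin n)} a,b∈))

  edgesK-unique : Unique (edgesK n)
  edgesK-unique = filter⁺ _ (cartesianProduct⁺ (allFin⁺ n) (allFin⁺ n))

  count-edgesK : (P : ℕ → ℕ → Bool) →
    count (λ u → P (toℕ (proj₁ u)) (toℕ (proj₂ u))) (edgesK n)
      ≡ sumBelow (λ a → countBelow (λ b → (a <ᵇ b) ∧ P a b) n) n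
  count-edgesK P =
    trans (count-filterᵇ _ _ (cartesianProduct (allFin n) (allFin n)))
      (trans (count-cartesianProduct _ (allFin n) (allFin n))
        (sum-tabulate n (λ x → x) _ _ (λ a → count-allFin n (λ b → (toℕ a <ᵇ b) ∧ P (toℕ a) b))))

  edge : Fin n → Fin n → Pair n
  edge i x = if toℕ x <ᵇ toℕ i then (x , i) else (i , x)

  edge-below : {i x : Fin n} → toℕ x < toℕ i → edge i x ≡ (x , i)
  edge-below x<i rewrite <ᵇ-true x<i = refl

  edge-above : {i x : Fin n} → toℕ i < toℕ x → edge i x ≡ (i , x)
  edge-above i<x rewrite <ᵇ-false (<⇒≤ i<x) = refl

  edge-injective : {i x y : Fin n} → edge i x ≡ edge i y → x ≡ y
  edge-injective {i} {x} {y} e with toℕ x <ᵇ toℕ i in x<i | toℕ y <ᵇ toℕ i in y<i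
  ... | true  | true  = cong proj₁ e
  ... | false | false = cong proj₂ e
  ... | true  | false = ⊥-elim (<-irrefl refl (<ᵇ-true⁻ {toℕ i} {toℕ i} (trans (cong (λ z → toℕ z <ᵇ toℕ i) (sym (cong proj₁ e))) x<i)))
  ... | false | true  = ⊥-elim (<-irrefl refl (<ᵇ-true⁻ {toℕ i} {toℕ i} (trans (cong (λ z → toℕ z <ᵇ toℕ i) (cong proj₁ e)) y<i)))

  edge-∈ : {i x : Fin n} → x ≢ i → edge i x ∈ edgesK n
  edge-∈ {i} {x} x≢i with toℕ x <ᵇ toℕ i in x<i
  ... | true  = ∈edgesK x i (<ᵇ-true⁻ x<i)
  ... | false = ∈edgesK i x (≤∧≢⇒< (<ᵇ-false⁻ x<i) (λ i≡x → x≢i (sym (toℕ-injective i≡x))))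

  edge-adjacent-i : {i j x : Fin n} → i ≢ j → x ≢ i → x ≢ j → adjL (i , j) (edge i x) ≡ true
  edge-adjacent-i {i} {j} {x} i≢j x≢i x≢j with toℕ x <ᵇ toℕ i
  ... | true  rewrite eqFin-≢ (≢-sym x≢i) | eqFin-refl i = refl
  ... | false rewrite eqFin-refl i | eqFin-≢ (≢-sym x≢j) = refl

  edge-adjacent-j : {i j y : Fin n} → i ≢ j → y ≢ i → y ≢ j → adjL (i , j) (edge j y) ≡ true
  edge-adjacent-j {i} {j} {y} i≢j y≢i y≢j with toℕ y <ᵇ toℕ j
  ... | true  rewrite eqFin-≢ (≢-sym y≢i) | eqFin-≢ i≢j | eqFin-≢ (≢-sym y≢j) | eqFin-refl j = refl
  ... | false rewrite eqFin-≢ i≢j | eqFin-≢ (≢-sym y≢i) | eqFin-refl j = refl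

  edges-distinct : {i j x y : Fin n} → i ≢ j → x ≢ j → y ≢ i → edge i x ≢ edge j y
  edges-distinct {i} {j} {x} {y} i≢j x≢j y≢i e with toℕ x <ᵇ toℕ i | toℕ y <ᵇ toℕ j
  ... | true  | true  = i≢j (cong proj₂ e)
  ... | true  | false = x≢j (cong proj₁ e)
  ... | false | true  = y≢i (sym (cong proj₁ e))
  ... | false | false = i≢j (cong proj₁ e)

  neighbours-≥ : (i j : Fin n) → toℕ i < toℕ j → (Q : Pair n → Bool) (qi qj : ℕ → Bool)
    → (∀ x → qi (toℕ x) ≡ true → x ≢ i × x ≢ j × Q (edge i x) ≡ true)
    → (∀ x → qj (toℕ x) ≡ true → x ≢ i × x ≢ j × Q (edge j x) ≡ true)
    → countBelow qi n + countBelow qj n ≤ count (λ u → adjL (i , j) u ∧ Q u) (edgesK n)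
  neighbours-≥ i j i<j Q qi qj at-i at-j =
    ≤-trans (≤-reflexive (sym length-L))
      (count-≥-unique (≡-dec _≟ᶠ_ _≟ᶠ_) (λ u → adjL (i , j) u ∧ Q u) (edgesK n) L unique-L L⊆ good)
    where
    i≢j : i ≢ j
    i≢j = <⇒≢ᶠ i<j
    xs ys : List (Fin n)
    xs = filterᵇ (λ x → qi (toℕ x)) (allFin n)
    ys = filterᵇ (λ x → qj (toℕ x)) (allFin n)
    L : List (Pair n)
    L = map (edge i) xs ++ map (edge j) ys
    length-L : length L ≡ countBelow qi n + countBelow qj n
    length-L = trans (length-++ (map (edge i) xs))
      (cong₂ _+_ (trans (length-map (edge i) xs) (trans (length-filterᵇ _ (allFin n)) (count-allFin n qi)))
                 (trans (length-map (edge j) ys) (trans (length-filterᵇ _ (allFin n)) (count-allFin n qj))))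
    ∈xs : ∀ {x} → x ∈ xs → qi (toℕ x) ≡ true
    ∈xs x∈ = T⇒true (proj₂ (∈-filter⁻ _ {xs = allFin n} x∈))
    ∈ys : ∀ {y} → y ∈ ys → qj (toℕ y) ≡ true
    ∈ys y∈ = T⇒true (proj₂ (∈-filter⁻ _ {xs = allFin n} y∈))
    unique-L : Unique L
    unique-L = ++⁺ (map⁺ edge-injective (filter⁺ _ (allFin⁺ n)))
                   (map⁺ edge-injective (filter⁺ _ (allFin⁺ n))) disjoint
      where
      disjoint : ∀ {v} → ¬ (v ∈ map (edge i) xs × v ∈ map (edge j) ys)
      disjoint (v∈i , v∈j) with ∈-map⁻ (edge i) v∈i | ∈-map⁻ (edge j) v∈j
      ... | x , x∈ , refl | y , y∈ , e =
        edges-distinct i≢j (proj₁ (proj₂ (at-i x (∈xs x∈)))) (proj₁ (at-j y (∈ys y∈))) e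
    cases : ∀ {w} → w ∈ L →
      (∃[ x ] (w ≡ edge i x × qi (toℕ x) ≡ true)) ⊎ (∃[ y ] (w ≡ edge j y × qj (toℕ y) ≡ true))
    cases w∈ with ∈-++⁻ (map (edge i) xs) w∈
    ... | inj₁ w∈i = let (x , x∈ , e) = ∈-map⁻ (edge i) w∈i in inj₁ (x , e , ∈xs x∈)
    ... | inj₂ w∈j = let (y , y∈ , e) = ∈-map⁻ (edge j) w∈j in inj₂ (y , e , ∈ys y∈)
    L⊆ : ∀ {w} → w ∈ L → w ∈ edgesK n
    L⊆ w∈ with cases w∈
    ... | inj₁ (x , refl , q) = edge-∈ (proj₁ (at-i x q))
    ... | inj₂ (y , refl , q) = edge-∈ (proj₁ (proj₂ (at-j y q)))
    good : ∀ {w} → w ∈ L → adjL (i , j) w ∧ Q w ≡ true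
    good w∈ with cases w∈
    ... | inj₁ (x , refl , q) = let (x≢i , x≢j , Qx) = at-i x q in
      trans (cong (_∧ Q (edge i x)) (edge-adjacent-i i≢j x≢i x≢j)) Qx
    ... | inj₂ (y , refl , q) = let (y≢i , y≢j , Qy) = at-j y q in
      trans (cong (_∧ Q (edge j y)) (edge-adjacent-j i≢j y≢i y≢j)) Qy

-- For i < j, the neighbours found at i (counted as i + (j-i-1) + (T-i)) and at j
-- (counted as i + (T-j) + E) number at least j + (T ∸ j) + T + E - 1.
neighbour-sum : ∀ i j T E → i < j →
  j + (T ∸ j) + T + E ≤ suc (i + ((j ∸ suc i) + (T ∸ i)) + (i + ((T ∸ j) + E)))
neighbour-sum i j T E i<j = begin
  j + (T ∸ j) + T + E
    ≡⟨ regroup j T (T ∸ j) E ⟩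
  j + (T + ((T ∸ j) + E))
    ≤⟨ +-mono-≤ (m≤n+m∸n j (suc i)) (+-monoˡ-≤ ((T ∸ j) + E) (m≤n+m∸n T i)) ⟩
  (suc i + (j ∸ suc i)) + ((i + (T ∸ i)) + ((T ∸ j) + E))
    ≡⟨ regroup′ i (j ∸ suc i) (T ∸ i) (T ∸ j) E ⟩
  suc (i + ((j ∸ suc i) + (T ∸ i)) + (i + ((T ∸ j) + E))) ∎
  where
  open ≤-Reasoning
  regroup : ∀ j T z E → j + z + T + E ≡ j + (T + (z + E))
  regroup = solve-∀
  regroup′ : ∀ i x y z E → (suc i + x) + ((i + y) + (z + E)) ≡ suc (i + (x + y) + (i + (z + E)))
  regroup′ = solve-∀

-- 2T + E exceeds r = 2t + o: for odd r since T = t + 1, for even r either through an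
-- extra neighbour (E ≥ 1) or because j > t makes j + (T ∸ j) exceed T.
exceeds-r : ∀ j t o E → (o ≡ false → j ≤ t → 1 ≤ E) →
  suc (t + t + bit o) ≤ j + ((t + bit o) ∸ j) + (t + bit o) + E
exceeds-r j t true E _ = begin
  suc (t + t + 1)                   ≡⟨ odd-r t ⟩
  (t + 1) + (t + 1)                 ≤⟨ +-monoˡ-≤ (t + 1) (m≤n+m∸n (t + 1) j) ⟩
  j + ((t + 1) ∸ j) + (t + 1)       ≤⟨ m≤m+n _ E ⟩
  j + ((t + 1) ∸ j) + (t + 1) + E   ∎
  where
  open ≤-Reasoning
  odd-r : ∀ t → suc (t + t + 1) ≡ (t + 1) + (t + 1)
  odd-r = solve-∀
exceeds-r j t false E extra with j ≤? t
... | yes j≤t = begin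
  suc (t + t + 0)                   ≡⟨ even-r t ⟩
  (t + 0) + (t + 0) + 1             ≤⟨ +-mono-≤ (+-monoˡ-≤ (t + 0) (m≤n+m∸n (t + 0) j)) (extra refl j≤t) ⟩
  j + ((t + 0) ∸ j) + (t + 0) + E   ∎
  where
  open ≤-Reasoning
  even-r : ∀ t → suc (t + t + 0) ≡ (t + 0) + (t + 0) + 1
  even-r = solve-∀
... | no j≰t = begin
  suc (t + t + 0)                   ≡⟨ even-r t ⟩
  suc (t + 0) + (t + 0)             ≤⟨ +-monoˡ-≤ (t + 0) t<j+[T∸j] ⟩
  j + ((t + 0) ∸ j) + (t + 0)       ≤⟨ m≤m+n _ E ⟩
  j + ((t + 0) ∸ j) + (t + 0) + E   ∎
  where
  open ≤-Reasoning
  even-r : ∀ t → suc (t + t + 0) ≡ suc (t + 0) + (t + 0)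
  even-r = solve-∀
  t<j+[T∸j] : suc (t + 0) ≤ j + ((t + 0) ∸ j)
  t<j+[T∸j] = ≤-trans (≤-trans (≤-reflexive (cong suc (+-identityʳ t))) (≰⇒> j≰t)) (m≤m+n j _)

-- The active neighbours of a short edge ij reach the threshold r = 2t + o.
threshold : ∀ i j t o E → i < j → (o ≡ false → j ≤ t → 1 ≤ E) →
  t + t + bit o ≤ i + ((j ∸ suc i) + ((t + bit o) ∸ i)) + (i + (((t + bit o) ∸ j) + E))
threshold i j t o E i<j extra = s≤s⁻¹ (≤-trans (exceeds-r j t o E extra) (neighbour-sum i j (t + bit o) E i<j))

matched-bound : ∀ b c m → 2 * sumBelow (λ a → bit (b ∧ (flips false a ∧ (a <ᵇ c)))) m ≤ bit b * c
matched-bound false c m = ≤-reflexive (cong (2 *_) (sumBelow-zero m))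
matched-bound true  c m = sumBelow-flips false c m

size-arith : ∀ t o → 4 * ((t + bit o) * suc (t + bit o) + bit (not o) * suc t) ≤ (t + t + bit o + 2) ^ 2
size-arith t true  = ≤-trans (m≤m+n _ 1) (≤-reflexive (odd-r t))
  where
  odd-r : ∀ t → 4 * ((t + 1) * suc (t + 1) + 0) + 1 ≡ (t + t + 1 + 2) * ((t + t + 1 + 2) * 1)
  odd-r = solve-∀
size-arith t false = ≤-reflexive (even-r t)
  where
  even-r : ∀ t → 4 * ((t + 0) * suc (t + 0) + 1 * suc t) ≡ (t + t + 0 + 2) * ((t + t + 0 + 2) * 1)
  even-r = solve-∀

≤-/8 : ∀ m N → 8 * m ≤ N → m ≤ N / 8
≤-/8 m N 8m≤N = ≤-trans (≤-reflexive (sym (m*n/n≡m m 8))) (/-monoˡ-≤ 8 (≤-trans (≤-reflexive (*-comm m 8)) 8m≤N))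

module Construction (t k : ℕ) (o : Bool) (1≤k : 1 ≤ k) where

  -- T′ = ⌈r/2⌉
  T′ : ℕ
  T′ = t + bit o

  n : ℕ
  n = suc (k + T′)

  r : ℕ
  r = t + t + bit o

  matched : ℕ → Bool
  matched a = not o ∧ (flips false a ∧ (a <ᵇ suc t))

  matching : ℕ → ℕ → Bool
  matching a b = matched a ∧ (b ≡ᵇ suc a)

  initialℕ : ℕ → ℕ → Bool
  initialℕ a b = (a + k <ᵇ b) ∨ matching a b

  initial : Pair n → Bool
  initial (a , b) = initialℕ (toℕ a) (toℕ b)

  A₀ : List (Pair n)
  A₀ = filterᵇ initial (edgesK n)

  open Bootstrap (LK n) eqPair r A₀

  matching⇒suc : ∀ a b → matching a b ≡ true → b ≡ suc a
  matching⇒suc a b m = ≡ᵇ⇒≡ b (suc a) (true⇒T (proj₂ (∧-true {matched a} m)))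

  ≢suc⇒¬matching : ∀ a b → b ≢ suc a → matching a b ≡ false
  ≢suc⇒¬matching a b b≢ with matching a b in m
  ... | true  = ⊥-elim (b≢ (matching⇒suc a b m))
  ... | false = refl

  matching-intro : ∀ a → o ≡ false → flips false a ≡ true → a ≤ t → matching a (suc a) ≡ true
  matching-intro a o≡false a-odd a≤t =
    cong₂ _∧_ (cong₂ _∧_ (cong not o≡false) (cong₂ _∧_ a-odd (<ᵇ-true (s≤s a≤t))))
              (T⇒true (≡⇒≡ᵇ a a refl))

  initial-long : ∀ a b → a + k < b → initialℕ a b ≡ true
  initial-long a b long rewrite <ᵇ-true long = refl

  initial-matching : ∀ a b → matching a b ≡ true → initialℕ a b ≡ true
  initial-matching a b m = trans (cong ((a + k <ᵇ b) ∨_) m) (∨-zeroʳ _)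

  long-count : ∀ a → countBelow (λ x → a + k <ᵇ x) n ≡ T′ ∸ a
  long-count a = trans (countBelow-≥ (suc (a + k)) n)
                       (trans (cong (λ z → (k + T′) ∸ z) (+-comm a k)) ([m+n]∸[m+o]≡n∸o k T′ a))

  row : ℕ → ℕ
  row a = countBelow (λ b → (a <ᵇ b) ∧ initialℕ a b) n

  row-bound : ∀ a → row a ≤ (T′ ∸ a) + bit (matched a)
  row-bound a =
    ≤-trans (countBelow-mono {q = λ b → (a + k <ᵇ b) ∨ matching a b} (λ b ab → proj₂ (∧-true {a <ᵇ b} ab)) n)
      (≤-trans (countBelow-∨ (λ b → a + k <ᵇ b) (matching a) n)
               (+-mono-≤ (≤-reflexive (long-count a)) (countBelow-single (matched a) (suc a) n)))

  twice-size : 2 * length A₀ ≤ T′ * suc T′ + bit (not o) * suc t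
  twice-size = begin
    2 * length A₀
      ≡⟨ cong (2 *_) (trans (length-filterᵇ initial (edgesK n)) (count-edgesK {n = n} initialℕ)) ⟩
    2 * sumBelow row n
      ≤⟨ *-monoʳ-≤ 2 (sumBelow-mono row-bound n) ⟩
    2 * sumBelow (λ a → (T′ ∸ a) + bit (matched a)) n
      ≡⟨ cong (2 *_) (sumBelow-+ (T′ ∸_) (λ a → bit (matched a)) n) ⟩
    2 * (sumBelow (T′ ∸_) n + sumBelow (λ a → bit (matched a)) n)
      ≡⟨ *-distribˡ-+ 2 (sumBelow (T′ ∸_) n) _ ⟩
    2 * sumBelow (T′ ∸_) n + 2 * sumBelow (λ a → bit (matched a)) n
      ≤⟨ +-mono-≤ (≤-reflexive (sumBelow-triangle T′ n (≤-trans (m≤n+m T′ k) (n≤1+n _))))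
                  (matched-bound (not o) (suc t) n) ⟩
    T′ * suc T′ + bit (not o) * suc t ∎
    where open ≤-Reasoning

  size : length A₀ ≤ ((r + 2) ^ 2) / 8
  size = ≤-/8 (length A₀) _ (begin
    8 * length A₀                                 ≡⟨ *-assoc 4 2 (length A₀) ⟩
    4 * (2 * length A₀)                           ≤⟨ *-monoʳ-≤ 4 twice-size ⟩
    4 * (T′ * suc T′ + bit (not o) * suc t)       ≤⟨ size-arith t o ⟩
    (r + 2) ^ 2                                   ∎)
    where open ≤-Reasoning

  A-mono : ∀ {i j} v → i ≤ j → A i v ≡ true → A j v ≡ true
  A-mono v i≤j = persist (≤⇒≤′ i≤j)
    where
    persist : ∀ {i j} → i ≤′ j → A i v ≡ true → A j v ≡ true
    persist ≤′-refl          a = a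
    persist (≤′-step i≤′j) a rewrite persist i≤′j a = refl

  A₀-active : (a b : Fin n) → toℕ a < toℕ b → initial (a , b) ≡ true → A 0 (a , b) ≡ true
  A₀-active a b a<b init =
    T⇒true (any⁺ (eqPair (a , b)) (lose (∈-filter⁺ _ (∈edgesK a b a<b) (true⇒T init))
                                        (true⇒T (eqPair-refl (a , b)))))

  rank : Fin n → Fin n → ℕ
  rank a b = toℕ a * n + toℕ b

  rank-lex : ∀ {a c b d} → a < c → b < n → a * n + b < c * n + d
  rank-lex {a} {c} {b} {d} a<c b<n = begin-strict
    a * n + b <⟨ +-monoʳ-< (a * n) b<n ⟩
    a * n + n ≡⟨ +-comm (a * n) n ⟩
    suc a * n ≤⟨ *-monoˡ-≤ n a<c ⟩
    c * n     ≤⟨ m≤m+n (c * n) d ⟩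
    c * n + d ∎
    where open ≤-Reasoning

  module Step (i j : Fin n) (i<j : toℕ i < toℕ j) (not-initial : initial (i , j) ≡ false)
              (earlier : ∀ a b → toℕ a < toℕ b → rank a b < rank i j → A (suc (rank a b)) (a , b) ≡ true)
              where

    R : ℕ
    R = rank i j

    i′ j′ : ℕ
    i′ = toℕ i
    j′ = toℕ j

    active : ∀ a b → toℕ a < toℕ b → initial (a , b) ≡ true ⊎ rank a b < R → A R (a , b) ≡ true
    active a b a<b (inj₁ init)   = A-mono {j = R} (a , b) z≤n (A₀-active a b a<b init)
    active a b a<b (inj₂ before) = A-mono {j = R} (a , b) before (earlier a b a<b before)

    short : j′ ≤ i′ + k
    short = <ᵇ-false⁻ (proj₁ (∨-false {i′ + k <ᵇ j′} not-initial))

    not-matching : matching i′ j′ ≡ false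
    not-matching = proj₂ (∨-false {i′ + k <ᵇ j′} not-initial)

    matching-at-j : ℕ → Bool
    matching-at-j y = matching j′ y ∨ ((i′ <ᵇ y) ∧ matching y j′)

    at-i : ℕ → Bool
    at-i x = (x <ᵇ i′) ∨ (interval (suc i′) j′ x ∨ (i′ + k <ᵇ x))

    at-j : ℕ → Bool
    at-j y = (y <ᵇ i′) ∨ ((j′ + k <ᵇ y) ∨ matching-at-j y)

    Active : Pair n → Set
    Active u = A R u ≡ true

    at-i-active : ∀ x → at-i (toℕ x) ≡ true → x ≢ i × x ≢ j × A R (edge i x) ≡ true
    at-i-active x q with ∨-true {toℕ x <ᵇ i′} q
    ... | inj₁ x<iᵇ = <⇒≢ᶠ x<i , <⇒≢ᶠ (<-trans x<i i<j) ,
          subst Active (sym (edge-below x<i)) (active x i x<i (inj₂ (rank-lex x<i (toℕ<n i))))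
      where
      x<i : toℕ x < i′
      x<i = <ᵇ-true⁻ x<iᵇ
    ... | inj₂ q′ with ∨-true {interval (suc i′) j′ (toℕ x)} q′
    ... | inj₁ between = ≢-sym (<⇒≢ᶠ i<x) , <⇒≢ᶠ x<j ,
          subst Active (sym (edge-above i<x)) (active i x i<x (inj₂ (+-monoʳ-< (i′ * n) x<j)))
      where
      i<x : i′ < toℕ x
      i<x = <ᵇ-true⁻ {i′} (proj₁ (∧-true {suc i′ ≤ᵇ toℕ x} between))
      x<j : toℕ x < j′
      x<j = <ᵇ-true⁻ (proj₂ (∧-true {suc i′ ≤ᵇ toℕ x} between))
    ... | inj₂ longᵇ = ≢-sym (<⇒≢ᶠ i<x) , ≢-sym (<⇒≢ᶠ (≤-<-trans short long)) ,
          subst Active (sym (edge-above i<x)) (active i x i<x (inj₁ (initial-long i′ (toℕ x) long)))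
      where
      long : i′ + k < toℕ x
      long = <ᵇ-true⁻ longᵇ
      i<x : i′ < toℕ x
      i<x = ≤-<-trans (m≤m+n i′ k) long

    at-j-active : ∀ y → at-j (toℕ y) ≡ true → y ≢ i × y ≢ j × A R (edge j y) ≡ true
    at-j-active y q with ∨-true {toℕ y <ᵇ i′} q
    ... | inj₁ y<iᵇ = <⇒≢ᶠ y<i , <⇒≢ᶠ y<j ,
          subst Active (sym (edge-below y<j)) (active y j y<j (inj₂ (rank-lex y<i (toℕ<n j))))
      where
      y<i : toℕ y < i′
      y<i = <ᵇ-true⁻ y<iᵇ
      y<j : toℕ y < j′
      y<j = <-trans y<i i<j
    ... | inj₂ q′ with ∨-true {j′ + k <ᵇ toℕ y} q′
    ... | inj₁ longᵇ = ≢-sym (<⇒≢ᶠ (<-trans i<j j<y)) , ≢-sym (<⇒≢ᶠ j<y) ,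
          subst Active (sym (edge-above j<y)) (active j y j<y (inj₁ (initial-long j′ (toℕ y) long)))
      where
      long : j′ + k < toℕ y
      long = <ᵇ-true⁻ longᵇ
      j<y : j′ < toℕ y
      j<y = ≤-<-trans (m≤m+n j′ k) long
    ... | inj₂ q″ with ∨-true {matching j′ (toℕ y)} q″
    ... | inj₁ m = ≢-sym (<⇒≢ᶠ (<-trans i<j j<y)) , ≢-sym (<⇒≢ᶠ j<y) ,
          subst Active (sym (edge-above j<y)) (active j y j<y (inj₁ (initial-matching j′ (toℕ y) m)))
      where
      j<y : j′ < toℕ y
      j<y = ≤-reflexive (sym (matching⇒suc j′ (toℕ y) m))
    ... | inj₂ im = ≢-sym (<⇒≢ᶠ i<y) , <⇒≢ᶠ y<j ,
          subst Active (sym (edge-below y<j)) (active y j y<j (inj₁ (initial-matching (toℕ y) j′ m)))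
      where
      m : matching (toℕ y) j′ ≡ true
      m = proj₂ (∧-true {i′ <ᵇ toℕ y} im)
      i<y : i′ < toℕ y
      i<y = <ᵇ-true⁻ (proj₁ (∧-true {i′ <ᵇ toℕ y} im))
      y<j : toℕ y < j′
      y<j = ≤-reflexive (sym (matching⇒suc (toℕ y) j′ m))

    below-i : countBelow (λ x → x <ᵇ i′) n ≡ i′
    below-i = trans (countBelow-< i′ n) (m≤n⇒m⊓n≡m (<⇒≤ (toℕ<n i)))

    at-i-count : i′ + ((j′ ∸ suc i′) + (T′ ∸ i′)) ≤ countBelow at-i n
    at-i-count = begin
      i′ + ((j′ ∸ suc i′) + (T′ ∸ i′))
        ≡⟨ sym (cong₂ _+_ below-i (cong₂ _+_ between (long-count i′))) ⟩
      countBelow (λ x → x <ᵇ i′) n + (countBelow (interval (suc i′) j′) n + countBelow (λ x → i′ + k <ᵇ x) n)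
        ≤⟨ +-monoʳ-≤ (countBelow (λ x → x <ᵇ i′) n)
                     (countBelow-∨-disjoint (interval (suc i′) j′) (λ x → i′ + k <ᵇ x) disjoint₂ n) ⟩
      countBelow (λ x → x <ᵇ i′) n + countBelow (λ x → interval (suc i′) j′ x ∨ (i′ + k <ᵇ x)) n
        ≤⟨ countBelow-∨-disjoint (λ x → x <ᵇ i′) (λ x → interval (suc i′) j′ x ∨ (i′ + k <ᵇ x)) disjoint₁ n ⟩
      countBelow at-i n ∎
      where
      open ≤-Reasoning
      between : countBelow (interval (suc i′) j′) n ≡ j′ ∸ suc i′
      between = trans (countBelow-interval (suc i′) j′ n) (cong (_∸ suc i′) (m≤n⇒m⊓n≡m (<⇒≤ (toℕ<n j))))
      disjoint₁ : ∀ x → (x <ᵇ i′) ≡ true → (interval (suc i′) j′ x ∨ (i′ + k <ᵇ x)) ≡ false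
      disjoint₁ x x<iᵇ = cong₂ _∨_ (cong (_∧ (x <ᵇ j′)) (<ᵇ-false {i′} {x} (<⇒≤ x<i)))
                                   (<ᵇ-false (≤-trans (<⇒≤ x<i) (m≤m+n i′ k)))
        where
        x<i : x < i′
        x<i = <ᵇ-true⁻ x<iᵇ
      disjoint₂ : ∀ x → interval (suc i′) j′ x ≡ true → (i′ + k <ᵇ x) ≡ false
      disjoint₂ x x∈ = <ᵇ-false (≤-trans (<⇒≤ (<ᵇ-true⁻ (proj₂ (∧-true {suc i′ ≤ᵇ x} x∈)))) short)

    at-j-count : i′ + ((T′ ∸ j′) + countBelow matching-at-j n) ≤ countBelow at-j n
    at-j-count = begin
      i′ + ((T′ ∸ j′) + countBelow matching-at-j n)
        ≡⟨ sym (cong₂ _+_ below-i (cong (_+ countBelow matching-at-j n) (long-count j′))) ⟩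
      countBelow (λ x → x <ᵇ i′) n + (countBelow (λ x → j′ + k <ᵇ x) n + countBelow matching-at-j n)
        ≤⟨ +-monoʳ-≤ (countBelow (λ x → x <ᵇ i′) n)
                     (countBelow-∨-disjoint (λ x → j′ + k <ᵇ x) matching-at-j disjoint₂ n) ⟩
      countBelow (λ x → x <ᵇ i′) n + countBelow (λ x → (j′ + k <ᵇ x) ∨ matching-at-j x) n
        ≤⟨ countBelow-∨-disjoint (λ x → x <ᵇ i′) (λ x → (j′ + k <ᵇ x) ∨ matching-at-j x) disjoint₁ n ⟩
      countBelow at-j n ∎
      where
      open ≤-Reasoning
      disjoint₁ : ∀ x → (x <ᵇ i′) ≡ true → ((j′ + k <ᵇ x) ∨ matching-at-j x) ≡ false
      disjoint₁ x x<iᵇ =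
        cong₂ _∨_ (<ᵇ-false (≤-trans (<⇒≤ x<j) (m≤m+n j′ k)))
                  (cong₂ _∨_ (≢suc⇒¬matching j′ x (<⇒≢ (<-trans x<j (n<1+n j′))))
                             (cong (_∧ matching x j′) (<ᵇ-false (<⇒≤ x<i))))
        where
        x<i : x < i′
        x<i = <ᵇ-true⁻ x<iᵇ
        x<j : x < j′
        x<j = <-trans x<i i<j
      disjoint₂ : ∀ x → (j′ + k <ᵇ x) ≡ true → matching-at-j x ≡ false
      disjoint₂ x longᵇ =
        cong₂ _∨_ (≢suc⇒¬matching j′ x x≢1+j) (trans (cong ((i′ <ᵇ x) ∧_) (≢suc⇒¬matching x j′ j≢1+x)) (∧-zeroʳ _))
        where
        long : j′ + k < x
        long = <ᵇ-true⁻ longᵇ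
        x≢1+j : x ≢ suc j′
        x≢1+j x≡ = <-irrefl refl (≤-<-trans (≤-trans (≤-reflexive x≡) 1+j≤j+k) long)
          where
          1+j≤j+k : suc j′ ≤ j′ + k
          1+j≤j+k = ≤-trans (≤-reflexive (+-comm 1 j′)) (+-monoʳ-≤ j′ 1≤k)
        j≢1+x : j′ ≢ suc x
        j≢1+x j≡ = <-irrefl refl (<-trans (subst (x <_) (sym j≡) (n<1+n x)) (≤-<-trans (m≤m+n j′ k) long))

    matching-after-j : o ≡ false → j′ ≤ t → flips false j′ ≡ true → 1 ≤ countBelow matching-at-j n
    matching-after-j o≡false j≤t j-odd =
      countBelow-witness matching-at-j (suc j′)
        (cong (_∨ ((i′ <ᵇ suc j′) ∧ matching (suc j′) j′)) (matching-intro j′ o≡false j-odd j≤t))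
        n (s≤s j<k+T′)
      where
      j<k+T′ : j′ < k + T′
      j<k+T′ = ≤-<-trans (≤-trans j≤t (m≤m+n t (bit o))) (m<n+m T′ 1≤k)

    -- For even j ≤ t (and even r) the edge (j-1, j) is an initial matching edge, and
    -- j - 1 ≠ i because ij itself is not initial.
    matching-before-j : o ≡ false → j′ ≤ t → flips false j′ ≡ false → 1 ≤ countBelow matching-at-j n
    matching-before-j o≡false j≤t j-even = countBelow-witness matching-at-j y y-matching n (<-trans y<j (toℕ<n j))
      where
      y : ℕ
      y = j′ ∸ 1
      1+y≡j : suc y ≡ j′
      1+y≡j = 1+[m∸1]≡m j′ (≤-<-trans z≤n i<j)
        where
        1+[m∸1]≡m : ∀ m → 0 < m → suc (m ∸ 1) ≡ m
        1+[m∸1]≡m (suc m) _ = refl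
      y<j : y < j′
      y<j = ≤-reflexive 1+y≡j
      y-odd : flips false y ≡ true
      y-odd = not-injective (trans (sym (flips-not false y)) (trans (cong (flips false) 1+y≡j) j-even))
      y-j : matching y j′ ≡ true
      y-j = subst (λ z → matching y z ≡ true) 1+y≡j
                  (matching-intro y o≡false y-odd (≤-trans (<⇒≤ y<j) j≤t))
      i<y : i′ < y
      i<y = ≤∧≢⇒< (s≤s⁻¹ (≤-trans i<j (≤-reflexive (sym 1+y≡j))))
                  (λ i≡y → false≢true (trans (sym not-matching) (subst (λ z → matching z j′ ≡ true) (sym i≡y) y-j)))
        where
        false≢true : false ≢ true
        false≢true ()
      y-matching : matching-at-j y ≡ true
      y-matching = trans (cong (matching j′ y ∨_) (trans (cong (_∧ matching y j′) (<ᵇ-true i<y)) y-j)) (∨-zeroʳ _)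

    matching-at-j-exists : o ≡ false → j′ ≤ t → 1 ≤ countBelow matching-at-j n
    matching-at-j-exists o≡false j≤t = by-parity (flips false j′) refl
      where
      by-parity : (b : Bool) → flips false j′ ≡ b → 1 ≤ countBelow matching-at-j n
      by-parity true  = matching-after-j o≡false j≤t
      by-parity false = matching-before-j o≡false j≤t

    enough-active : r ≤ count (λ u → adjL (i , j) u ∧ A R u) (edgesK n)
    enough-active = begin
      r
        ≤⟨ threshold i′ j′ t o (countBelow matching-at-j n) i<j matching-at-j-exists ⟩
      i′ + ((j′ ∸ suc i′) + (T′ ∸ i′)) + (i′ + ((T′ ∸ j′) + countBelow matching-at-j n))
        ≤⟨ +-mono-≤ at-i-count at-j-count ⟩
      countBelow at-i n + countBelow at-j n
        ≤⟨ neighbours-≥ i j i<j (A R) at-i at-j at-i-active at-j-active ⟩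
      count (λ u → adjL (i , j) u ∧ A R u) (edgesK n) ∎
      where open ≤-Reasoning

  step : (i j : Fin n) → toℕ i < toℕ j →
    (∀ a b → toℕ a < toℕ b → rank a b < rank i j → A (suc (rank a b)) (a , b) ≡ true) →
    A (suc (rank i j)) (i , j) ≡ true
  step i j i<j earlier with initial (i , j) in init
  ... | true  = A-mono {j = suc (rank i j)} (i , j) z≤n (A₀-active i j i<j init)
  ... | false = trans (cong (A (rank i j) (i , j) ∨_) (T⇒true (≤⇒≤ᵇ enough-active))) (∨-zeroʳ _)
    where open Step i j i<j init earlier

  active-by-rank : ∀ m (a b : Fin n) → toℕ a < toℕ b → rank a b < m → A (suc (rank a b)) (a , b) ≡ true
  active-by-rank (suc m) a b a<b rank<m =
    step a b a<b (λ a′ b′ a′<b′ before → active-by-rank m a′ b′ a′<b′ (≤-trans before (s≤s⁻¹ rank<m)))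

  percolates : Percolates
  percolates (a , b) ab∈ = suc (rank a b) , active-by-rank (suc (rank a b)) a b (∈edgesK⁻ ab∈) ≤-refl

  percolating-set : m≤ (LK n) eqPair r (((r + 2) ^ 2) / 8)
  percolating-set =
    A₀ , All.tabulate (λ u∈ → proj₁ (∈-filter⁻ _ {xs = edgesK n} u∈)) ,
    filter⁺ (λ u → T? (initial u)) edgesK-unique , size , percolates

parity : ∀ r → ∃[ t ] ∃[ o ] (r ≡ t + t + bit o)
parity zero = 0 , false , refl
parity (suc r) with parity r
... | t , false , refl = t , true , even→odd t
  where
  even→odd : ∀ t → suc (t + t + 0) ≡ t + t + 1
  even→odd = solve-∀
... | t , true , refl = suc t , false , odd→even t
  where
  odd→even : ∀ t → suc (t + t + 1) ≡ suc t + suc t + 0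
  odd→even = solve-∀

⌈/2⌉-parity : ∀ t o → ⌈ t + t + bit o /2⌉ ≡ t + bit o
⌈/2⌉-parity t false = trans (cong ⌈_/2⌉ (+-identityʳ (t + t))) (trans (sym (n≡⌈n+n/2⌉ t)) (sym (+-identityʳ t)))
⌈/2⌉-parity t true  = trans (cong ⌈_/2⌉ (+-comm (t + t) 1)) (trans (cong suc (sym (n≡⌊n+n/2⌋ t))) (+-comm 1 t))

vertex-split : ∀ {T n} → T + 2 ≤ n → ∃[ k ] (1 ≤ k × n ≡ suc (k + T))
vertex-split {T} {n} T+2≤n =
  n ∸ suc T , m<n⇒0<n∸m 1+T<n , trans (sym (m∸n+n≡m (<⇒≤ 1+T<n))) (+-suc (n ∸ suc T) T)
  where
  1+T<n : suc T < n
  1+T<n = ≤-trans (≤-reflexive (+-comm 2 T)) T+2≤n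

lemma5p2 : (n r : ℕ) → ⌈ r /2⌉ + 2 ≤ n →
    m≤ (LK n) eqPair r (((r + 2) ^ 2) / 8)
lemma5p2 n r ⌈r/2⌉+2≤n with parity r
... | t , o , refl with vertex-split (subst (λ c → c + 2 ≤ n) (⌈/2⌉-parity t o) ⌈r/2⌉+2≤n)
... | k , 1≤k , refl = Construction.percolating-set t k o 1≤k
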